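{- Let $m\ge 3$ be odd and $n\ge 1$. Run Algorithm ODD-COMPRESSED (described in the context) and record, after initialization and after every single turn of any disk, the tuple $(a_n,\dots,a_1)$ where $a_i$ is the value shown by disk $D_i$. Then the sequence of recorded tuples is exactly the $m$-ary reflected Gray code $G_n$ of length $n$.
   Context: There are three pegs $P_0,P_1,P_2$ and disks $D_1,\dots,D_n$ of increasing sizes; each disk carries a dial whose state cycles through the $2m-2$ states $0,\ 1\!\uparrow,\ 2\!\uparrow,\dots,(m-2)\!\uparrow,\ m-1,\ (m-2)\!\downarrow,\dots,1\!\downarrow$ and then back to $0$; the value of a state is its number ($0,\dots,m-1$). A disk showing $0$ lies on $P_0$, a disk showing $m-1$ lies on $P_2$, all other disks lie on $P_1$. To turn a disk means to advance its dial to the next state and, if necessary, move it (to the top of the stack of) the peg corresponding to its new value. Algorithm ODD-COMPRESSED: Initially all disks are on $P_0$ showing $0$. Repeat: (i) turn $D_1$ $m-1$ times, until it arrives at $P_0$ or $P_2$; (ii) let $D_k$ be the smaller of the topmost disks of the two pegs not carrying $D_1$; if there is no such disk, terminate; (iii) turn $D_k$ once. The $m$-ary reflected Gray code $G_n$: $G_0$ consists of the empty tuple; if $G_n=C_1,\dots,C_{m^n}$, then $G_{n+1}$ lists, for $i=1,\dots,m^n$ in order, the tuples $C_ix$ with $x$ running $0,1,\dots,m-1$ for odd $i$ and $m-1,\dots,0$ for even $i$, where $C_ix$ has digits $(a_{n+1},\dots,a_2)$ equal to those of $C_i$ and last digit $a_1=x$. -}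

module Defs where

open import Data.Nat using (ℕ; zero; suc; _+_; _*_; _∸_; _≤ᵇ_; _≡ᵇ_; _<ᵇ_)
open import Data.Bool using (Bool; true; false; if_then_else_; not)
open import Data.List using (List; []; _∷_; _++_; map; upTo; downFrom; reverse; [_])
open import Data.Maybe using (Maybe; just; nothing)
open import Data.Product using (_×_; _,_)

-- A dial state is encoded as a natural number s ∈ {0,…,2m-3}:
--   s = 0,1,…,m-1   encode  0, 1↑, …, (m-2)↑, m-1
--   s = m-1+j       encodes (m-1-j)↓   (j = 1,…,m-2)
-- The cyclic successor is s ↦ s+1 mod (2m-2).

module _ (m : ℕ) where

  value : ℕ → ℕ
  value s = if s ≤ᵇ (m ∸ 1) then s else (2 * m ∸ 2) ∸ s

  nextState : ℕ → ℕ
  nextState s = if suc s ≡ᵇ (2 * m ∸ 2) then 0 else suc s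

  pegOf : ℕ → ℕ
  pegOf v = if v ≡ᵇ 0 then 0 else (if v ≡ᵇ (m ∸ 1) then 2 else 1)

-- Configurations: the dial state of each disk D_i (indexed by i ≥ 1)
-- and the three peg stacks, each a list of disk indices, top first.

record Config : Set where
  constructor config
  field
    dial : ℕ → ℕ
    pegs : ℕ → List ℕ
open Config public

remove : ℕ → List ℕ → List ℕ
remove k [] = []
remove k (j ∷ js) = if j ≡ᵇ k then remove k js else j ∷ remove k js

module _ (m : ℕ) where

  turn : ℕ → Config → Config
  turn k c = record
    { dial = λ i → if i ≡ᵇ k then s' else dial c i
    ; pegs = λ q → if p ≡ᵇ p' then pegs c q
                   else (if q ≡ᵇ p then remove k (pegs c q)
                   else (if q ≡ᵇ p' then k ∷ pegs c q else pegs c q))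
    }
    where
      s  = dial c k
      s' = nextState m s
      p  = pegOf m (value m s)
      p' = pegOf m (value m s')

  tuple : ℕ → Config → List ℕ
  tuple n c = map (λ i → value m (dial c (suc i))) (downFrom n)

  turns : ℕ → ℕ → ℕ → Config → Config × List (List ℕ)
  turns n k zero    c = c , []
  turns n k (suc t) c with turns n k t (turn k c)
  ... | c' , tr = c' , (tuple n (turn k c) ∷ tr)

  top : List ℕ → Maybe ℕ
  top [] = nothing
  top (j ∷ _) = just j

  smaller : Maybe ℕ → Maybe ℕ → Maybe ℕ
  smaller nothing  y        = y
  smaller (just a) nothing  = just a
  smaller (just a) (just b) = if a <ᵇ b then just a else just b

  chooseDisk : Config → Maybe ℕ
  chooseDisk c with pegOf m (value m (dial c 1))
  ... | 0 = smaller (top (pegs c 1)) (top (pegs c 2))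
  ... | 1 = smaller (top (pegs c 0)) (top (pegs c 2))
  ... | _ = smaller (top (pegs c 0)) (top (pegs c 1))

  appendTo : List (List ℕ) → Maybe (List (List ℕ)) → Maybe (List (List ℕ))
  appendTo xs nothing   = nothing
  appendTo xs (just ys) = just (xs ++ ys)

  -- run at most `fuel` iterations of the repeat-loop; `nothing` means the
  -- algorithm did not terminate within the given number of iterations;
  -- `just tr` is the list of tuples recorded after every single turn.
  runLoop : ℕ → ℕ → Config → Maybe (List (List ℕ))
  runLoop n zero c = nothing
  runLoop n (suc fuel) c with turns n 1 (m ∸ 1) c
  ... | c₁ , tr₁ with chooseDisk c₁
  ...   | nothing = just tr₁
  ...   | just k  = appendTo (tr₁ ++ [ tuple n (turn k c₁) ]) (runLoop n fuel (turn k c₁))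

  initial : ℕ → Config
  initial n = record
    { dial = λ _ → 0
    ; pegs = λ q → if q ≡ᵇ 0 then map suc (upTo n) else []
    }

  oddCompressed : ℕ → ℕ → Maybe (List (List ℕ))
  oddCompressed n fuel =
    appendTo [ tuple n (initial n) ] (runLoop n fuel (initial n))

-- m-ary reflected Gray code G_n; tuples are lists (a_n, …, a_1).

module _ (m : ℕ) where

  extend : Bool → List (List ℕ) → List (List ℕ)
  extend odd [] = []
  extend odd (C ∷ Cs) =
    map (λ x → C ++ [ x ]) (if odd then upTo m else reverse (upTo m))
      ++ extend (not odd) Cs

  gray : ℕ → List (List ℕ)
  gray zero    = [ [] ]
  gray (suc n) = extend true (gray n)

-- Write m = M + 1 with M even. Call a tower of height K the disks D_1, …, D_K all showing the same end value,
-- 0 or M, and stacked on P₀ or P₂ respectively. Induction on K shows that the next m^(K-1) iterations of the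
-- algorithm carry such a tower to the other end peg while recording the K-digit sweep: the tuples obtained by
-- letting D_K run through all m values, and between any two of its turns letting the tower of height K - 1
-- sweep back or forth. Between two sub-sweeps the sub-tower sits on P₀ or P₂ with D_1 on top, so step (ii)
-- selects D_K, as long as D_K does not lie on the peg where the sub-tower ends up; since M is even, the
-- sub-tower alternates between P₀ and P₂ in step with D_K's dial so that this never happens. Finally, every
-- block of a sweep has odd length m^(K-1), so appending the last digit in alternating directions, as in the
-- definition of G_n, produces the same list as prepending the first digit as in a sweep.

module Submission where

open import Defs
open import Data.Nat using (ℕ; _≤_; _%_)
open import Data.Product using (∃-syntax)
open import Data.Maybe using (just)
open import Relation.Binary.PropositionalEquality using (_≡_)

open import Data.Nat using (zero; suc; pred; _+_; _*_; _∸_; _^_; _<_; z≤n; s≤s; NonZero; >-nonZero; _≡ᵇ_; _<ᵇ_; _≤ᵇ_)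
open import Data.Nat.Properties
open import Data.Nat.DivMod using ([m+n]%n≡m%n)
open import Data.Bool using (Bool; true; false; not; if_then_else_)
open import Data.Bool.Properties using (not-involutive; not-injective; T-≡)
open import Data.List using (List; []; _∷_; _++_; map; drop; upTo; downFrom; reverse; [_]; replicate; length; _∷ʳ_)
open import Data.List.Properties using (++-assoc; ++-identityʳ; map-++; length-map; length-++; upTo-∷ʳ; reverse-upTo; map-∘; map-cong; map-id)
open import Data.List.Relation.Unary.All as All using (All; []; _∷_)
open import Data.List.Relation.Unary.All.Properties using (++⁺)
open import Data.Maybe using (Maybe; nothing)
open import Data.Product using (_×_; _,_; proj₁; proj₂)
open import Data.Sum using (_⊎_; inj₁; inj₂)
open import Data.Empty using (⊥-elim)
open import Function.Base using (id; case_of_)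
open import Function.Bundles using (Equivalence)
open import Relation.Binary.PropositionalEquality using (_≢_; refl; sym; trans; cong; cong₂; subst; subst₂; module ≡-Reasoning)

≡ᵇ-refl : ∀ a → (a ≡ᵇ a) ≡ true
≡ᵇ-refl a = Equivalence.to T-≡ (≡⇒≡ᵇ a a refl)

≡ᵇ≡true⇒≡ : ∀ a b → (a ≡ᵇ b) ≡ true → a ≡ b
≡ᵇ≡true⇒≡ a b e = ≡ᵇ⇒≡ a b (Equivalence.from T-≡ e)

≢⇒≡ᵇ≡false : ∀ a b → a ≢ b → (a ≡ᵇ b) ≡ false
≢⇒≡ᵇ≡false zero    zero    a≢b = ⊥-elim (a≢b refl)
≢⇒≡ᵇ≡false zero    (suc b) a≢b = refl
≢⇒≡ᵇ≡false (suc a) zero    a≢b = refl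
≢⇒≡ᵇ≡false (suc a) (suc b) a≢b = ≢⇒≡ᵇ≡false a b (λ a≡b → a≢b (cong suc a≡b))

<⇒≡ᵇ≡false : ∀ {a b} → a < b → (a ≡ᵇ b) ≡ false
<⇒≡ᵇ≡false {a} {b} a<b = ≢⇒≡ᵇ≡false a b (<⇒≢ a<b)

<⇒<ᵇ≡true : ∀ {a b} → a < b → (a <ᵇ b) ≡ true
<⇒<ᵇ≡true a<b = Equivalence.to T-≡ (<⇒<ᵇ a<b)

≥⇒<ᵇ≡false : ∀ a b → b ≤ a → (a <ᵇ b) ≡ false
≥⇒<ᵇ≡false a       zero    _         = refl
≥⇒<ᵇ≡false (suc a) (suc b) (s≤s b≤a) = ≥⇒<ᵇ≡false a b b≤a

≤⇒≤ᵇ≡true : ∀ {a b} → a ≤ b → (a ≤ᵇ b) ≡ true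
≤⇒≤ᵇ≡true a≤b = Equivalence.to T-≡ (≤⇒≤ᵇ a≤b)

>⇒≤ᵇ≡false : ∀ a b → b < a → (a ≤ᵇ b) ≡ false
>⇒≤ᵇ≡false (suc a) b (s≤s b≤a) = ≥⇒<ᵇ≡false a b b≤a

toggle : ℕ → Bool → Bool
toggle zero    b = b
toggle (suc n) b = not (toggle n b)

odd : ℕ → Bool
odd n = toggle n false

toggle-not : ∀ n b → toggle n (not b) ≡ not (toggle n b)
toggle-not zero    b = refl
toggle-not (suc n) b = cong not (toggle-not n b)

toggle-+ : ∀ a c b → toggle (a + c) b ≡ toggle a (toggle c b)
toggle-+ zero    c b = refl
toggle-+ (suc a) c b = cong not (toggle-+ a c b)

toggle-even : ∀ a → odd a ≡ false → ∀ b → toggle a b ≡ b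
toggle-even a even false = even
toggle-even a even true  = trans (toggle-not a false) (cong not even)

toggle-* : ∀ y → (∀ b → toggle y b ≡ not b) → ∀ x b → toggle (x * y) b ≡ toggle x b
toggle-* y odd-y zero    b = refl
toggle-* y odd-y (suc x) b =
  trans (toggle-+ y (x * y) b) (trans (odd-y _) (cong not (toggle-* y odd-y x b)))

%2≡1⇒odd : ∀ x → x % 2 ≡ 1 → odd x ≡ true
%2≡1⇒odd (suc zero)    _ = refl
%2≡1⇒odd (suc (suc x)) p = trans (not-involutive (odd x))
  (%2≡1⇒odd x (trans (sym ([m+n]%n≡m%n x 2)) (trans (cong (_% 2) (+-comm x 2)) p)))

appendTo-++ : ∀ m xs ys r → appendTo m xs (appendTo m ys r) ≡ appendTo m (xs ++ ys) r
appendTo-++ m xs ys nothing   = refl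
appendTo-++ m xs ys (just zs) = cong just (sym (++-assoc xs ys zs))

stackAt : ℕ → List ℕ → ℕ → List ℕ
stackAt P xs q = if q ≡ᵇ P then xs else []

tower : ℕ → List ℕ
tower zero    = []
tower (suc K) = tower K ++ [ suc K ]

map-suc-upTo : ∀ K → map suc (upTo K) ≡ tower K
map-suc-upTo zero    = refl
map-suc-upTo (suc K) = begin
  map suc (upTo (suc K))       ≡⟨ cong (map suc) (sym (upTo-∷ʳ K)) ⟩
  map suc (upTo K ++ [ K ])    ≡⟨ map-++ suc (upTo K) [ K ] ⟩
  map suc (upTo K) ++ [ suc K ] ≡⟨ cong (_++ [ suc K ]) (map-suc-upTo K) ⟩
  tower (suc K)                ∎
  where open ≡-Reasoning

tower-≤ : ∀ K → All (_≤ K) (tower K)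
tower-≤ zero    = []
tower-≤ (suc K) = ++⁺ (All.map (λ i≤K → ≤-trans i≤K (n≤1+n K)) (tower-≤ K)) (≤-refl ∷ [])

remove-∷ : ∀ x B → All (_≢ x) B → remove x (x ∷ B) ≡ B
remove-∷ x B x∉B rewrite ≡ᵇ-refl x = remove-∉ B x∉B
  where
  remove-∉ : ∀ B → All (_≢ x) B → remove x B ≡ B
  remove-∉ []       []          = refl
  remove-∉ (y ∷ B) (y≢x ∷ x∉B) rewrite ≢⇒≡ᵇ≡false y x y≢x = cong (y ∷_) (remove-∉ B x∉B)

stackAt-++ : ∀ P xs ys q Z → stackAt P (xs ++ ys) q ++ Z ≡ stackAt P xs q ++ (stackAt P ys q ++ Z)
stackAt-++ P xs ys q Z with q ≡ᵇ P
... | true  = ++-assoc xs ys Z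
... | false = refl

stackAt-swap : ∀ P P′ xs ys q Z → P ≢ P′ →
  stackAt P xs q ++ (stackAt P′ ys q ++ Z) ≡ stackAt P′ ys q ++ (stackAt P xs q ++ Z)
stackAt-swap P P′ xs ys q Z P≢P′ with q ≡ᵇ P in q≟P | q ≡ᵇ P′ in q≟P′
... | true  | true  = ⊥-elim (P≢P′ (trans (sym (≡ᵇ≡true⇒≡ q P q≟P)) (≡ᵇ≡true⇒≡ q P′ q≟P′)))
... | true  | false = refl
... | false | true  = refl
... | false | false = refl

stackAt-All : ∀ {P : ℕ → Set} X xs q → All P xs → All P (stackAt X xs q)
stackAt-All X xs q all with q ≡ᵇ X
... | true  = all
... | false = []

extend-map : ∀ m b v Cs → extend m b (map (v ∷_) Cs) ≡ map (v ∷_) (extend m b Cs)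
extend-map m b v []       = refl
extend-map m b v (C ∷ Cs) = trans
  (cong₂ _++_ (map-∘ (if b then upTo m else reverse (upTo m))) (extend-map m (not b) v Cs))
  (sym (map-++ (v ∷_) _ (extend m (not b) Cs)))

extend-++ : ∀ m b Cs Ds → extend m b (Cs ++ Ds) ≡ extend m b Cs ++ extend m (toggle (length Cs) b) Ds
extend-++ m b []       Ds = refl
extend-++ m b (C ∷ Cs) Ds = trans
  (cong (map (λ x → C ++ [ x ]) digits ++_)
    (trans (extend-++ m (not b) Cs Ds) (cong (λ b′ → extend m (not b) Cs ++ extend m b′ Ds) (toggle-not (length Cs) b))))
  (sym (++-assoc (map (λ x → C ++ [ x ]) digits) (extend m (not b) Cs) _))
  where
  digits : List ℕ
  digits = if b then upTo m else reverse (upTo m)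

map-++-∷ : ∀ {A : Set} (U : List A) v Ts → map ((U ++ [ v ]) ++_) Ts ≡ map (U ++_) (map (v ∷_) Ts)
map-++-∷ U v Ts = trans (map-cong (++-assoc U [ v ]) Ts) (map-∘ Ts)

module OddCompressed (M : ℕ) (2≤M : 2 ≤ M) (M-even : odd M ≡ false) where

  m : ℕ
  m = suc M

  0<M : 0 < M
  0<M = ≤-trans (s≤s z≤n) 2≤M

  instance
    M-nonZero : NonZero M
    M-nonZero = >-nonZero 0<M

  val : ℕ → ℕ
  val = value m

  next : ℕ → ℕ
  next = nextState m

  peg : ℕ → ℕ
  peg s = pegOf m (val s)

  -- the dial state of a disk on P₀ (false) or P₂ (true); it is also the value the disk shows
  end : Bool → ℕ
  end false = 0
  end true  = M

  endPeg : Bool → ℕ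
  endPeg false = 0
  endPeg true  = 2

  advance : ℕ → ℕ → ℕ
  advance zero    s = s
  advance (suc r) s = advance r (next s)

  2m∸2≡M+M : 2 * m ∸ 2 ≡ M + M
  2m∸2≡M+M rewrite +-identityʳ M | +-suc M M = refl

  value-≤ : ∀ {s} → s ≤ M → val s ≡ s
  value-≤ s≤M rewrite ≤⇒≤ᵇ≡true s≤M = refl

  value-M+ : ∀ {i} → i ≤ M → val (M + i) ≡ M ∸ i
  value-M+ {zero} _ rewrite +-identityʳ M | ≤⇒≤ᵇ≡true (≤-refl {M}) = refl
  value-M+ {suc i} _ rewrite >⇒≤ᵇ≡false (M + suc i) M (m<m+n M (s≤s z≤n)) | 2m∸2≡M+M =
    [m+n]∸[m+o]≡n∸o M M (suc i)

  value-end : ∀ e → val (end e) ≡ end e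
  value-end false = refl
  value-end true  = value-≤ ≤-refl

  next-suc : ∀ {s} → suc s < M + M → next s ≡ suc s
  next-suc s<2M rewrite 2m∸2≡M+M | <⇒≡ᵇ≡false s<2M = refl

  next-up : ∀ {s} → s < M → next s ≡ suc s
  next-up s<M = next-suc (≤-<-trans s<M (m<m+n M 0<M))

  next-down : ∀ {i} → suc i < M → next (M + i) ≡ M + suc i
  next-down {i} i+1<M =
    trans (next-suc (subst (_< M + M) (+-suc M i) (+-monoʳ-< M i+1<M))) (sym (+-suc M i))

  next-last : ∀ {i} → suc i ≡ M → next (M + i) ≡ 0
  next-last {i} i+1≡M rewrite 2m∸2≡M+M | sym (+-suc M i) | i+1≡M | ≡ᵇ-refl (M + M) = refl

  value-next-M+ : ∀ {i} → i < M → val (next (M + i)) ≡ M ∸ suc i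
  value-next-M+ {i} i<M with m≤n⇒m<n∨m≡n i<M
  ... | inj₁ i+1<M = trans (cong val (next-down i+1<M)) (value-M+ (<⇒≤ i+1<M))
  ... | inj₂ i+1≡M = trans (cong val (next-last i+1≡M)) (sym (trans (cong (M ∸_) i+1≡M) (n∸n≡0 M)))

  advance-up : ∀ r j → j + r ≤ M → advance r j ≡ j + r
  advance-up zero    j _ = sym (+-identityʳ j)
  advance-up (suc r) j j+r+1≤M rewrite next-up (<-≤-trans (m<m+n j (s≤s z≤n)) j+r+1≤M) =
    trans (advance-up r (suc j) (subst (_≤ M) (+-suc j r) j+r+1≤M)) (sym (+-suc j r))

  advance-down : ∀ r i → suc i + r ≡ M → advance (suc r) (M + i) ≡ 0
  advance-down zero    i i+1≡M = next-last (trans (sym (+-identityʳ (suc i))) i+1≡M)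
  advance-down (suc r) i i+r+2≡M rewrite next-down {i} (subst (suc i <_) i+r+2≡M (m<m+n (suc i) (s≤s z≤n))) =
    advance-down r (suc i) (trans (sym (+-suc (suc i) r)) i+r+2≡M)

  advance-end : ∀ e → advance M (end e) ≡ end (not e)
  advance-end false = advance-up M 0 ≤-refl
  advance-end true  = subst₂ (λ r s → advance r s ≡ 0) (suc-pred M) (+-identityʳ M) (advance-down (pred M) 0 (suc-pred M))

  peg-end : ∀ e → peg (end e) ≡ endPeg e
  peg-end false = refl
  peg-end true rewrite value-≤ (≤-refl {M}) | ≢⇒≡ᵇ≡false M 0 (>⇒≢ 0<M) | ≡ᵇ-refl M = refl

  pegOf≡endPeg⇒ : ∀ v e → pegOf m v ≡ endPeg e → v ≡ end e
  pegOf≡endPeg⇒ v e p with v ≡ᵇ 0 in v≟0 | v ≡ᵇ M in v≟M | e | p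
  ... | true  | _     | false | _  = ≡ᵇ≡true⇒≡ v 0 v≟0
  ... | false | true  | true  | _  = ≡ᵇ≡true⇒≡ v M v≟M
  ... | true  | _     | true  | ()
  ... | false | true  | false | ()
  ... | false | false | false | ()
  ... | false | false | true  | ()

  peg≢endPeg : ∀ s e → val s ≢ end e → peg s ≢ endPeg e
  peg≢endPeg s e s-free on-end = s-free (pegOf≡endPeg⇒ (val s) e on-end)

  pegOf-cases : ∀ v → pegOf m v ≡ 0 ⊎ pegOf m v ≡ 1 ⊎ pegOf m v ≡ 2
  pegOf-cases v with v ≡ᵇ 0 | v ≡ᵇ M
  ... | true  | _     = inj₁ refl
  ... | false | true  = inj₂ (inj₂ refl)
  ... | false | false = inj₂ (inj₁ refl)

  dialValues : ℕ → ℕ → List ℕ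
  dialValues s zero    = []
  dialValues s (suc r) = val (next s) ∷ dialValues (next s) r

  dialValues-∷ʳ : ∀ r s → dialValues s (suc r) ≡ dialValues s r ∷ʳ val (advance (suc r) s)
  dialValues-∷ʳ zero    s = refl
  dialValues-∷ʳ (suc r) s = cong (val (next s) ∷_) (dialValues-∷ʳ r (next s))

  dialValues-up : ∀ r → r ≤ M → 0 ∷ dialValues 0 r ≡ upTo (suc r)
  dialValues-up zero    _     = refl
  dialValues-up (suc r) r+1≤M = begin
    0 ∷ dialValues 0 (suc r)                         ≡⟨ cong (0 ∷_) (dialValues-∷ʳ r 0) ⟩
    (0 ∷ dialValues 0 r) ∷ʳ val (advance (suc r) 0)  ≡⟨ cong₂ _∷ʳ_ (dialValues-up r (≤-trans (n≤1+n r) r+1≤M))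
                                                              (trans (cong val (advance-up (suc r) 0 r+1≤M)) (value-≤ r+1≤M)) ⟩
    upTo (suc r) ∷ʳ suc r                            ≡⟨ upTo-∷ʳ (suc r) ⟩
    upTo (suc (suc r))                               ∎
    where open ≡-Reasoning

  dialValues-down : ∀ r i → suc i + r ≡ M → dialValues (M + i) (suc r) ≡ downFrom (suc r)
  dialValues-down zero    i i+1≡M rewrite next-last (trans (sym (+-identityʳ (suc i))) i+1≡M) = refl
  dialValues-down (suc r) i i+r+2≡M
    rewrite next-down {i} (subst (suc i <_) i+r+2≡M (m<m+n (suc i) (s≤s z≤n))) =
    cong₂ _∷_ shown (dialValues-down r (suc i) i+r+2≡M′)
    where
    i+r+2≡M′ : suc (suc i) + r ≡ M
    i+r+2≡M′ = trans (sym (+-suc (suc i) r)) i+r+2≡M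
    shown : val (M + suc i) ≡ suc r
    shown = trans (value-M+ (m+n≤o⇒m≤o (suc i) (≤-reflexive i+r+2≡M)))
                  (trans (cong (_∸ suc i) (sym i+r+2≡M)) (m+n∸m≡n (suc i) (suc r)))

  dialValues-end : ∀ e → val (end e) ∷ dialValues (end e) M ≡ (if not e then upTo m else reverse (upTo m))
  dialValues-end false = dialValues-up M ≤-refl
  dialValues-end true  = begin
    val M ∷ dialValues M M                      ≡⟨ cong₂ _∷_ (value-end true) (subst₂ (λ r s → dialValues s r ≡ downFrom r)
                                                     (suc-pred M) (+-identityʳ M) (dialValues-down (pred M) 0 (suc-pred M))) ⟩
    downFrom m                                  ≡⟨ sym (reverse-upTo m) ⟩
    reverse (upTo m)                            ∎
    where open ≡-Reasoning

  -- sweep K e: the tuples (a_K, …, a_1) shown while the tower D_K, …, D_1 travels from end e to end (not e);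
  -- stages K s e r: the same with D_{K+1} in state s above it, turned r more times between the tower's sweeps.
  mutual
    sweep : ℕ → Bool → List (List ℕ)
    sweep zero    e = [ [] ]
    sweep (suc K) e = stages K (end e) e M

    stages : ℕ → ℕ → Bool → ℕ → List (List ℕ)
    stages K s e zero    = map (val s ∷_) (sweep K e)
    stages K s e (suc r) = map (val s ∷_) (sweep K e) ++ stages K (next s) (not e) r

  mutual
    length-sweep : ∀ K e → length (sweep K e) ≡ m ^ K
    length-sweep zero    e = refl
    length-sweep (suc K) e = length-stages K (end e) e M

    length-stages : ∀ K s e r → length (stages K s e r) ≡ suc r * m ^ K
    length-stages K s e zero    = trans (length-map _ (sweep K e)) (trans (length-sweep K e) (sym (+-identityʳ _)))
    length-stages K s e (suc r) = trans (length-++ (map (val s ∷_) (sweep K e)))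
      (cong₂ _+_ (trans (length-map _ (sweep K e)) (length-sweep K e)) (length-stages K (next s) (not e) r))

  toggle-m^ : ∀ K b → toggle (m ^ K) b ≡ not b
  toggle-m^ zero    b = refl
  toggle-m^ (suc K) b = trans (toggle-* (m ^ K) (toggle-m^ K) m b) (cong not (toggle-even M M-even b))

  stages-0 : ∀ s e r → stages 0 s e r ≡ map [_] (val s ∷ dialValues s r)
  stages-0 s e zero    = refl
  stages-0 s e (suc r) = cong ([ val s ] ∷_) (stages-0 (next s) (not e) r)

  extend-sweep-0 : ∀ e → extend m (not e) (sweep 0 e) ≡ sweep 1 e
  extend-sweep-0 e = begin
    extend m (not e) [ [] ]                                ≡⟨ ++-identityʳ _ ⟩
    map [_] (if not e then upTo m else reverse (upTo m))   ≡⟨ cong (map [_]) (sym (dialValues-end e)) ⟩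
    map [_] (val (end e) ∷ dialValues (end e) M)           ≡⟨ sym (stages-0 (end e) e M) ⟩
    sweep 1 e                                              ∎
    where open ≡-Reasoning

  extend-stages : ∀ K → (∀ e → extend m (not e) (sweep K e) ≡ sweep (suc K) e) →
    ∀ r s e → extend m (not e) (stages K s e r) ≡ stages (suc K) s e r
  extend-stages K extend-sweep-K zero s e =
    trans (extend-map m (not e) (val s) (sweep K e)) (cong (map (val s ∷_)) (extend-sweep-K e))
  extend-stages K extend-sweep-K (suc r) s e = begin
    extend m (not e) (map (val s ∷_) (sweep K e) ++ rest)
      ≡⟨ extend-++ m (not e) (map (val s ∷_) (sweep K e)) rest ⟩
    extend m (not e) (map (val s ∷_) (sweep K e)) ++ extend m (toggle (length (map (val s ∷_) (sweep K e))) (not e)) rest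
      ≡⟨ cong₂ _++_ (extend-stages K extend-sweep-K zero s e) (cong (λ b → extend m b rest) toggled) ⟩
    stages (suc K) s e zero ++ extend m (not (not e)) rest
      ≡⟨ cong (stages (suc K) s e zero ++_) (extend-stages K extend-sweep-K r (next s) (not e)) ⟩
    stages (suc K) s e (suc r)
      ∎
    where
    open ≡-Reasoning
    rest : List (List ℕ)
    rest = stages K (next s) (not e) r
    -- each block of the lower sweep has odd length m ^ K, so it reverses the direction of the last digit
    toggled : toggle (length (map (val s ∷_) (sweep K e))) (not e) ≡ not (not e)
    toggled = trans (cong (λ l → toggle l (not e)) (trans (length-map _ (sweep K e)) (length-sweep K e))) (toggle-m^ K (not e))

  extend-sweep : ∀ K e → extend m (not e) (sweep K e) ≡ sweep (suc K) e
  extend-sweep zero    e = extend-sweep-0 e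
  extend-sweep (suc K) e = extend-stages K (extend-sweep K) M (end e) e

  gray≡sweep : ∀ K → gray m K ≡ sweep K false
  gray≡sweep zero    = refl
  gray≡sweep (suc K) = trans (cong (extend m true) (gray≡sweep K)) (extend-sweep K false)

  mutual
    sweep-head : ∀ K e → sweep K e ≡ replicate K (val (end e)) ∷ drop 1 (sweep K e)
    sweep-head zero    e = refl
    sweep-head (suc K) e = stages-head K (end e) e M

    stages-head : ∀ K s e r → stages K s e r ≡ (val s ∷ replicate K (val (end e))) ∷ drop 1 (stages K s e r)
    stages-head K s e zero    rewrite sweep-head K e = refl
    stages-head K s e (suc r) rewrite sweep-head K e = refl

  drop-stages-zero : ∀ K s e → drop 1 (stages K s e zero) ≡ map (val s ∷_) (drop 1 (sweep K e))
  drop-stages-zero K s e rewrite sweep-head K e = refl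

  drop-stages-suc : ∀ K s e r →
    drop 1 (stages K s e (suc r)) ≡ map (val s ∷_) (drop 1 (sweep K e)) ++ stages K (next s) (not e) r
  drop-stages-suc K s e r rewrite sweep-head K e = refl

  prefix-stages-zero : ∀ U K s e →
    map ((U ++ [ val s ]) ++_) (drop 1 (sweep K e)) ≡ map (U ++_) (drop 1 (stages K s e zero))
  prefix-stages-zero U K s e =
    trans (map-++-∷ U (val s) (drop 1 (sweep K e))) (cong (map (U ++_)) (sym (drop-stages-zero K s e)))

  prefix-stages-suc : ∀ U K s e r →
    map ((U ++ [ val s ]) ++_) (drop 1 (sweep K e)) ++
      (U ++ val (next s) ∷ replicate K (val (end (not e)))) ∷ map (U ++_) (drop 1 (stages K (next s) (not e) r))
    ≡ map (U ++_) (drop 1 (stages K s e (suc r)))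
  prefix-stages-suc U K s e r = begin
    map ((U ++ [ val s ]) ++_) (drop 1 (sweep K e)) ++
      (U ++ val (next s) ∷ replicate K (val (end (not e)))) ∷ map (U ++_) (drop 1 rest)
      ≡⟨ cong (map ((U ++ [ val s ]) ++_) (drop 1 (sweep K e)) ++_)
              (cong (map (U ++_)) (sym (stages-head K (next s) (not e) r))) ⟩
    map ((U ++ [ val s ]) ++_) (drop 1 (sweep K e)) ++ map (U ++_) rest
      ≡⟨ cong (_++ map (U ++_) rest) (map-++-∷ U (val s) (drop 1 (sweep K e))) ⟩
    map (U ++_) (map (val s ∷_) (drop 1 (sweep K e))) ++ map (U ++_) rest
      ≡⟨ sym (map-++ (U ++_) (map (val s ∷_) (drop 1 (sweep K e))) rest) ⟩
    map (U ++_) (map (val s ∷_) (drop 1 (sweep K e)) ++ rest)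
      ≡⟨ cong (map (U ++_)) (sym (drop-stages-suc K s e r)) ⟩
    map (U ++_) (drop 1 (stages K s e (suc r)))
      ∎
    where
    open ≡-Reasoning
    rest : List (List ℕ)
    rest = stages K (next s) (not e) r

  record DiskAt (k s : ℕ) (B : ℕ → List ℕ) (c : Config) : Set where
    field
      dial≡ : dial c k ≡ s
      pegs≡ : ∀ q → pegs c q ≡ stackAt (peg s) [ k ] q ++ B q

  turn-dial-self : ∀ k c → dial (turn m k c) k ≡ next (dial c k)
  turn-dial-self k c rewrite ≡ᵇ-refl k = refl

  turn-dial-other : ∀ k c {i} → i ≢ k → dial (turn m k c) i ≡ dial c i
  turn-dial-other k c {i} i≢k rewrite ≢⇒≡ᵇ≡false i k i≢k = refl

  turn-DiskAt : ∀ {k s B c} → DiskAt k s B c → (∀ q → All (_≢ k) (B q)) → DiskAt k (next s) B (turn m k c)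
  turn-DiskAt {k} {s} {B} {c} at k∉B = record
    { dial≡ = trans (turn-dial-self k c) (cong next dial≡)
    ; pegs≡ = pegs-turn
    }
    where
    open DiskAt at
    pegs-turn : ∀ q → pegs (turn m k c) q ≡ stackAt (peg (next s)) [ k ] q ++ B q
    pegs-turn q rewrite dial≡ | pegs≡ q with peg s ≡ᵇ peg (next s) in same
    ... | true rewrite ≡ᵇ≡true⇒≡ (peg s) (peg (next s)) same = refl
    ... | false with q ≡ᵇ peg s in q≟P
    ...   | true rewrite ≡ᵇ≡true⇒≡ q (peg s) q≟P | same = remove-∷ k (B (peg s)) (k∉B (peg s))
    ...   | false with q ≡ᵇ peg (next s)
    ...     | true  = refl
    ...     | false = refl

  record SameAbove (K : ℕ) (c c′ : Config) : Set where
    constructor sameAbove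
    field
      above : ∀ i → K < i → dial c′ i ≡ dial c i
  open SameAbove

  sameAbove-refl : ∀ {K c} → SameAbove K c c
  sameAbove-refl = sameAbove λ _ _ → refl

  sameAbove-trans : ∀ {K L c c′ c″} → SameAbove L c c′ → SameAbove K c′ c″ → K ≤ L → SameAbove L c c″
  sameAbove-trans same same′ K≤L = sameAbove λ i L<i → trans (above same′ i (≤-<-trans K≤L L<i)) (above same i L<i)

  turn-sameAbove : ∀ k c → SameAbove k c (turn m k c)
  turn-sameAbove k c = sameAbove λ i k<i → turn-dial-other k c (>⇒≢ k<i)

  upperDigits : ℕ → ℕ → Config → List ℕ
  upperDigits zero    K c = []
  upperDigits (suc j) K c = val (dial c (suc (j + K))) ∷ upperDigits j K c

  tuple-+ : ∀ j K c → tuple m (j + K) c ≡ upperDigits j K c ++ tuple m K c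
  tuple-+ zero    K c = refl
  tuple-+ (suc j) K c = cong (val (dial c (suc (j + K))) ∷_) (tuple-+ j K c)

  tuple-split : ∀ {n K} c → K ≤ n → tuple m n c ≡ upperDigits (n ∸ K) K c ++ tuple m K c
  tuple-split {n} {K} c K≤n =
    subst (λ l → tuple m l c ≡ upperDigits (n ∸ K) K c ++ tuple m K c) (m∸n+n≡m K≤n) (tuple-+ (n ∸ K) K c)

  upperDigits-cong : ∀ j K {c c′} → SameAbove K c c′ → upperDigits j K c′ ≡ upperDigits j K c
  upperDigits-cong zero    K same = refl
  upperDigits-cong (suc j) K same = cong₂ _∷_ (cong val (above same (suc (j + K)) (s≤s (m≤n+m K j)))) (upperDigits-cong j K same)

  upperDigits-suc : ∀ j K c → upperDigits (suc j) K c ≡ upperDigits j (suc K) c ++ [ val (dial c (suc K)) ]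
  upperDigits-suc zero    K c = refl
  upperDigits-suc (suc j) K c = cong₂ _∷_ (cong (λ i → val (dial c (suc i))) (sym (+-suc j K))) (upperDigits-suc j K c)

  tuple-end : ∀ K e c → (∀ i → i < K → dial c (suc i) ≡ end e) → tuple m K c ≡ replicate K (val (end e))
  tuple-end zero    e c at-end = refl
  tuple-end (suc K) e c at-end =
    cong₂ _∷_ (cong val (at-end K ≤-refl)) (tuple-end K e c (λ i i<K → at-end i (≤-trans i<K (n≤1+n K))))

  -- The disk above a tower starts in state s and is turned r more times, once between consecutive sweeps of
  -- the tower, the first of which starts at end e; before and after each turn it avoids the end where the
  -- current sweep of the tower finishes, and it ends in state end E.
  Admissible : ℕ → Bool → ℕ → Bool → Set
  Admissible s e zero    E = s ≡ end E × E ≡ not e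
  Admissible s e (suc r) E = val s ≢ end (not e) × val (next s) ≢ end (not e) × Admissible (next s) (not e) r E

  up-avoids : ∀ j → j < M → val j ≢ end (not (odd j)) × val (next j) ≢ end (not (odd j))
  up-avoids j j<M rewrite value-≤ (<⇒≤ j<M) | next-up j<M | value-≤ j<M with odd j in odd-j
  ... | false = <⇒≢ j<M , λ j+1≡M → case trans (cong not (sym odd-j)) (trans (cong odd j+1≡M) M-even) of λ ()
  ... | true  = (λ j≡0 → case trans (sym odd-j) (cong odd j≡0) of λ ()) , λ ()

  down-avoids : ∀ i → i < M → val (M + i) ≢ end (not (not (odd i))) × val (next (M + i)) ≢ end (not (not (odd i)))
  down-avoids i i<M rewrite value-M+ (<⇒≤ i<M) | value-next-M+ i<M | not-involutive (odd i) with odd i in odd-i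
  ... | false = (λ M∸i≡0 → <⇒≱ i<M (m∸n≡0⇒m≤n M∸i≡0)) , λ M∸[i+1]≡0 →
    case trans (cong not (sym odd-i)) (trans (cong odd (≤-antisym i<M (m∸n≡0⇒m≤n M∸[i+1]≡0))) M-even) of λ ()
  ... | true  = (λ M∸i≡M → case trans (sym odd-i) (cong odd (∸-cancelˡ-≡ (<⇒≤ i<M) z≤n M∸i≡M)) of λ ()) ,
    λ M∸[i+1]≡M → <⇒≢ (∸-monoʳ-< (s≤s z≤n) i<M) M∸[i+1]≡M

  admissible-up : ∀ r j → j + r ≡ M → Admissible j (odd j) r true
  admissible-up zero    j j+0≡M = j≡M , sym (cong not (trans (cong odd j≡M) M-even))
    where
    j≡M : j ≡ M
    j≡M = trans (sym (+-identityʳ j)) j+0≡M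
  admissible-up (suc r) j j+r+1≡M = proj₁ (up-avoids j j<M) , proj₂ (up-avoids j j<M) ,
    subst (λ s → Admissible s (not (odd j)) r true) (sym (next-up j<M))
      (admissible-up r (suc j) (trans (sym (+-suc j r)) j+r+1≡M))
    where
    j<M : j < M
    j<M = subst (j <_) j+r+1≡M (m<m+n j (s≤s z≤n))

  admissible-down : ∀ r i → suc i + r ≡ M → Admissible (M + i) (not (odd i)) (suc r) false
  admissible-down zero    i i+1+0≡M = proj₁ (down-avoids i i<M) , proj₂ (down-avoids i i<M) ,
    next-last i+1≡M , sym (cong (λ b → not (not b)) (trans (cong odd i+1≡M) M-even))
    where
    i+1≡M : suc i ≡ M
    i+1≡M = trans (sym (+-identityʳ (suc i))) i+1+0≡M
    i<M : i < M
    i<M = ≤-reflexive i+1≡M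
  admissible-down (suc r) i i+r+2≡M = proj₁ (down-avoids i i<M) , proj₂ (down-avoids i i<M) ,
    subst (λ s → Admissible s (not (not (odd i))) (suc r) false) (sym (next-down i+1<M))
      (admissible-down r (suc i) (trans (sym (+-suc (suc i) r)) i+r+2≡M))
    where
    i+1<M : suc i < M
    i+1<M = subst (suc i <_) i+r+2≡M (m<m+n (suc i) (s≤s z≤n))
    i<M : i < M
    i<M = <-trans (n<1+n i) i+1<M

  admissible-end : ∀ e → Admissible (end e) e M (not e)
  admissible-end false = admissible-up M 0 refl
  admissible-end true  = subst₂ (λ s r → Admissible s true r false) (+-identityʳ M) (suc-pred M)
    (admissible-down (pred M) 0 (suc-pred M))

  -- B q lists the disks on peg q outside the tower
  record TowerOn (K : ℕ) (e : Bool) (B : ℕ → List ℕ) (c : Config) : Set where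
    field
      tower-dials : ∀ i → i < K → dial c (suc i) ≡ end e
      tower-pegs  : ∀ q → pegs c q ≡ stackAt (endPeg e) (tower K) q ++ B q
      rest-larger : ∀ q → All (K <_) (B q)

  -- the disks outside the tower D_1, …, D_K when D_{K+1}, in state s, is the only one of them not in B
  underTower : ℕ → ℕ → (ℕ → List ℕ) → ℕ → List ℕ
  underTower K s B q = stackAt (peg s) [ suc K ] q ++ B q

  towerOn-split : ∀ {K e B c} → TowerOn (suc K) e B c → TowerOn K e (underTower K (end e) B) c
  towerOn-split {K} {e} {B} I = record
    { tower-dials = λ i i<K → tower-dials i (m<n⇒m<1+n i<K)
    ; tower-pegs  = λ q → trans (tower-pegs q) (trans (stackAt-++ (endPeg e) (tower K) [ suc K ] q (B q))
        (cong (λ P → stackAt (endPeg e) (tower K) q ++ (stackAt P [ suc K ] q ++ B q)) (sym (peg-end e))))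
    ; rest-larger = λ q → ++⁺ (stackAt-All (peg (end e)) [ suc K ] q (n<1+n K ∷ []))
        (All.map (<-trans (n<1+n K)) (rest-larger q))
    }
    where open TowerOn I

  towerOn-join : ∀ {K e B c} → TowerOn K e (underTower K (end e) B) c → dial c (suc K) ≡ end e →
    (∀ q → All (suc K <_) (B q)) → TowerOn (suc K) e B c
  towerOn-join {K} {e} {B} {c} I top B-larger = record
    { tower-dials = dials
    ; tower-pegs  = λ q → trans (tower-pegs q) (trans
        (cong (λ P → stackAt (endPeg e) (tower K) q ++ (stackAt P [ suc K ] q ++ B q)) (peg-end e))
        (sym (stackAt-++ (endPeg e) (tower K) [ suc K ] q (B q))))
    ; rest-larger = B-larger
    }
    where
    open TowerOn I
    dials : ∀ i → i < suc K → dial c (suc i) ≡ end e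
    dials i i<K+1 with m<1+n⇒m<n∨m≡n i<K+1
    ... | inj₁ i<K  = tower-dials i i<K
    ... | inj₂ refl = top

  towerOn⇒diskAt : ∀ {e B c} → TowerOn 1 e B c → DiskAt 1 (end e) B c
  towerOn⇒diskAt {e} {B} I = record
    { dial≡ = tower-dials 0 (s≤s z≤n)
    ; pegs≡ = λ q → trans (tower-pegs q) (cong (λ P → stackAt P [ 1 ] q ++ B q) (sym (peg-end e)))
    }
    where open TowerOn I

  diskAt⇒towerOn : ∀ {e B c} → DiskAt 1 (end e) B c → (∀ q → All (1 <_) (B q)) → TowerOn 1 e B c
  diskAt⇒towerOn {e} {B} at B-larger = record
    { tower-dials = λ { zero _ → dial≡ ; (suc _) (s≤s ()) }
    ; tower-pegs  = λ q → trans (pegs≡ q) (cong (λ P → stackAt P [ 1 ] q ++ B q) (peg-end e))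
    ; rest-larger = B-larger
    }
    where open DiskAt at

  chooseDisk-P₀ : ∀ c → peg (dial c 1) ≡ 0 → chooseDisk m c ≡ smaller m (top m (pegs c 1)) (top m (pegs c 2))
  chooseDisk-P₀ c on-0 with pegOf m (value m (dial c 1)) | on-0
  ... | _ | refl = refl

  chooseDisk-P₂ : ∀ c → peg (dial c 1) ≡ 2 → chooseDisk m c ≡ smaller m (top m (pegs c 0)) (top m (pegs c 1))
  chooseDisk-P₂ c on-2 with pegOf m (value m (dial c 1)) | on-2
  ... | _ | refl = refl

  smaller-picks : ∀ k P q₁ q₂ (B : ℕ → List ℕ) → P ≡ q₁ ⊎ P ≡ q₂ → q₁ ≢ q₂ → (∀ q → All (k <_) (B q)) →
    smaller m (top m (stackAt P [ k ] q₁ ++ B q₁)) (top m (stackAt P [ k ] q₂ ++ B q₂)) ≡ just k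
  smaller-picks k P q₁ q₂ B (inj₁ refl) q₁≢q₂ B-larger
    rewrite ≡ᵇ-refl P | ≢⇒≡ᵇ≡false q₂ P (λ q₂≡P → q₁≢q₂ (sym q₂≡P)) with B q₂ | B-larger q₂
  ... | []    | _       = refl
  ... | b ∷ _ | k<b ∷ _ rewrite <⇒<ᵇ≡true k<b = refl
  smaller-picks k P q₁ q₂ B (inj₂ refl) q₁≢q₂ B-larger
    rewrite ≢⇒≡ᵇ≡false q₁ P q₁≢q₂ | ≡ᵇ-refl P with B q₁ | B-larger q₁
  ... | []    | _       = refl
  ... | b ∷ _ | k<b ∷ _ rewrite ≥⇒<ᵇ≡false b k (<⇒≤ k<b) = refl

  module Run (n : ℕ) where

    -- steps (ii) and (iii) of an iteration, followed by at most f further iterations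
    resume : ℕ → Config → Maybe (List (List ℕ))
    resume f c with chooseDisk m c
    ... | nothing = just []
    ... | just k  = appendTo m [ tuple m n (turn m k c) ] (runLoop m n f (turn m k c))

    resume-just : ∀ f c {k} → chooseDisk m c ≡ just k →
      resume f c ≡ appendTo m [ tuple m n (turn m k c) ] (runLoop m n f (turn m k c))
    resume-just f c chosen with chooseDisk m c | chosen
    ... | just _ | refl = refl

    resume-nothing : ∀ f c → chooseDisk m c ≡ nothing → resume f c ≡ just []
    resume-nothing f c none with chooseDisk m c | none
    ... | nothing | refl = refl

    turns-suc : ∀ k t c → turns m n k (suc t) c ≡
      (proj₁ (turns m n k t (turn m k c)) , tuple m n (turn m k c) ∷ proj₂ (turns m n k t (turn m k c)))
    turns-suc k t c with turns m n k t (turn m k c)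
    ... | _ , _ = refl

    runLoop-suc : ∀ f c →
      runLoop m n (suc f) c ≡ appendTo m (proj₂ (turns m n 1 M c)) (resume f (proj₁ (turns m n 1 M c)))
    runLoop-suc f c with turns m n 1 M c
    ... | c₁ , tr₁ with chooseDisk m c₁
    ...   | nothing = cong just (sym (++-identityʳ tr₁))
    ...   | just k  = sym (appendTo-++ m tr₁ _ (runLoop m n f (turn m k c₁)))

    -- Starting from c, a iterations of the loop, the last one stopped after its step (i), record tr and
    -- reach a configuration satisfying P; f is the fuel left for the rest of the run.
    record Runs (c : Config) (a : ℕ) (tr : List (List ℕ)) (P : Config → Set) : Set where
      constructor runs
      field
        run : ∀ f → ∃[ c′ ] P c′ × runLoop m n (a + f) c ≡ appendTo m tr (resume f c′)

    runs-cast : ∀ {c a a′ tr tr′} {P Q : Config → Set} → a ≡ a′ → tr ≡ tr′ → (∀ {c′} → P c′ → Q c′) →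
      Runs c a tr P → Runs c a′ tr′ Q
    runs-cast refl refl P⇒Q (runs run) = runs λ f → let c′ , p , loop = run f in c′ , P⇒Q p , loop

    runs-chain : ∀ {c a b k t tr₁ tr₂} {P Q : Config → Set} → Runs c a tr₁ P →
      (∀ {c′} → P c′ → chooseDisk m c′ ≡ just k × tuple m n (turn m k c′) ≡ t × Runs (turn m k c′) b tr₂ Q) →
      Runs c (a + b) (tr₁ ++ t ∷ tr₂) Q
    runs-chain {c} {a} {b} {k} {t} {tr₁} {tr₂} {Q = Q} (runs run₁) continue = runs λ f → chain f
      where
      chain : ∀ f → ∃[ c″ ] Q c″ × runLoop m n (a + b + f) c ≡ appendTo m (tr₁ ++ t ∷ tr₂) (resume f c″)
      chain f with run₁ (b + f)
      ... | c′ , p , loop₁ with continue p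
      ...   | chosen , shown , runs run₂ with run₂ f
      ...     | c″ , q , loop₂ = c″ , q , (begin
        runLoop m n (a + b + f) c
          ≡⟨ cong (λ a′ → runLoop m n a′ c) (+-assoc a b f) ⟩
        runLoop m n (a + (b + f)) c
          ≡⟨ loop₁ ⟩
        appendTo m tr₁ (resume (b + f) c′)
          ≡⟨ cong (appendTo m tr₁) (resume-just (b + f) c′ chosen) ⟩
        appendTo m tr₁ (appendTo m [ tuple m n (turn m k c′) ] (runLoop m n (b + f) (turn m k c′)))
          ≡⟨ cong₂ (λ u r → appendTo m tr₁ (appendTo m [ u ] r)) shown loop₂ ⟩
        appendTo m tr₁ (appendTo m [ t ] (appendTo m tr₂ (resume f c″)))
          ≡⟨ cong (appendTo m tr₁) (appendTo-++ m [ t ] tr₂ _) ⟩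
        appendTo m tr₁ (appendTo m (t ∷ tr₂) (resume f c″))
          ≡⟨ appendTo-++ m tr₁ (t ∷ tr₂) _ ⟩
        appendTo m (tr₁ ++ t ∷ tr₂) (resume f c″)
          ∎)
        where open ≡-Reasoning

    runs-stop : ∀ {c a tr} {P : Config → Set} → Runs c a tr P → (∀ {c′} → P c′ → chooseDisk m c′ ≡ nothing) →
      runLoop m n (a + 0) c ≡ just tr
    runs-stop {tr = tr} (runs run) stops with run 0
    ... | c′ , p , loop = trans loop (trans (cong (appendTo m tr) (resume-nothing 0 c′ (stops p))) (cong just (++-identityʳ tr)))

    turns-D₁ : ∀ r {s B c} → 1 ≤ n → DiskAt 1 s B c → (∀ q → All (1 <_) (B q)) →
      DiskAt 1 (advance r s) B (proj₁ (turns m n 1 r c)) × SameAbove 1 c (proj₁ (turns m n 1 r c)) ×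
      proj₂ (turns m n 1 r c) ≡ map (λ v → upperDigits (n ∸ 1) 1 c ++ [ v ]) (dialValues s r)
    turns-D₁ zero    _   at B-larger = at , sameAbove-refl , refl
    turns-D₁ (suc r) {s} {B} {c} 1≤n at B-larger rewrite turns-suc 1 r c with turns-D₁ r 1≤n at₁ B-larger
      where
      at₁ : DiskAt 1 (next s) B (turn m 1 c)
      at₁ = turn-DiskAt at (λ q → All.map >⇒≢ (B-larger q))
    ... | at′ , same′ , trace′ =
      at′ , sameAbove-trans (turn-sameAbove 1 c) same′ ≤-refl ,
      cong₂ _∷_ shown (trans trace′ (cong (λ u → map (λ v → u ++ [ v ]) (dialValues (next s) r)) upper-same))
      where
      upper-same : upperDigits (n ∸ 1) 1 (turn m 1 c) ≡ upperDigits (n ∸ 1) 1 c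
      upper-same = upperDigits-cong (n ∸ 1) 1 (turn-sameAbove 1 c)
      shown : tuple m n (turn m 1 c) ≡ upperDigits (n ∸ 1) 1 c ++ [ val (next s) ]
      shown = trans (tuple-split (turn m 1 c) 1≤n)
        (cong₂ (λ u v → u ++ [ val v ]) upper-same (trans (turn-dial-self 1 c) (cong next (DiskAt.dial≡ at))))

    TowerSweeps : ℕ → Set
    TowerSweeps k = ∀ e B c → TowerOn (suc k) e B c →
      Runs c (m ^ k) (map (upperDigits (n ∸ suc k) (suc k) c ++_) (drop 1 (sweep (suc k) e)))
        (λ c′ → TowerOn (suc k) (not e) B c′ × SameAbove (suc k) c c′)

    towerSweeps-0 : 1 ≤ n → TowerSweeps 0
    towerSweeps-0 1≤n e B c I = runs λ f → swept f
      where
      swept : ∀ f → ∃[ c′ ] (TowerOn 1 (not e) B c′ × SameAbove 1 c c′) ×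
        runLoop m n (1 + f) c ≡ appendTo m (map (upperDigits (n ∸ 1) 1 c ++_) (drop 1 (sweep 1 e))) (resume f c′)
      swept f with turns-D₁ M 1≤n (towerOn⇒diskAt I) (TowerOn.rest-larger I)
      ... | at′ , same , trace =
        proj₁ (turns m n 1 M c) ,
        (diskAt⇒towerOn (subst (λ s → DiskAt 1 s B (proj₁ (turns m n 1 M c))) (advance-end e) at′) (TowerOn.rest-larger I) , same) ,
        trans (runLoop-suc f c) (cong (λ tr → appendTo m tr (resume f (proj₁ (turns m n 1 M c)))) (trans trace
          (trans (map-∘ (dialValues (end e) M)) (cong (λ l → map (upper ++_) (drop 1 l)) (sym (stages-0 (end e) e M))))))
        where
        upper : List ℕ
        upper = upperDigits (n ∸ 1) 1 c

    module TowerStep (k : ℕ) (k+2≤n : suc (suc k) ≤ n) (sweeps-k : TowerSweeps k)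
                (B : ℕ → List ℕ) (B-larger : ∀ q → All (suc (suc k) <_) (B q)) where

      K : ℕ
      K = suc k

      chooses-top : ∀ {e s c} → TowerOn K e (underTower K s B) c → val s ≢ end e → chooseDisk m c ≡ just (suc K)
      chooses-top {false} {s} {c} I s-free
        rewrite chooseDisk-P₀ c (trans (cong peg (TowerOn.tower-dials I 0 (s≤s z≤n))) (peg-end false))
              | TowerOn.tower-pegs I 1 | TowerOn.tower-pegs I 2
        = smaller-picks (suc K) (peg s) 1 2 B on-1-or-2 (λ ()) B-larger
        where
        on-1-or-2 : peg s ≡ 1 ⊎ peg s ≡ 2
        on-1-or-2 with pegOf-cases (val s)
        ... | inj₁ on-0 = ⊥-elim (peg≢endPeg s false s-free on-0)
        ... | inj₂ on-1-or-2 = on-1-or-2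
      chooses-top {true} {s} {c} I s-free
        rewrite chooseDisk-P₂ c (trans (cong peg (TowerOn.tower-dials I 0 (s≤s z≤n))) (peg-end true))
              | TowerOn.tower-pegs I 0 | TowerOn.tower-pegs I 1
        = smaller-picks (suc K) (peg s) 0 1 B on-0-or-1 (λ ()) B-larger
        where
        on-0-or-1 : peg s ≡ 0 ⊎ peg s ≡ 1
        on-0-or-1 with pegOf-cases (val s)
        ... | inj₁ on-0 = inj₁ on-0
        ... | inj₂ (inj₁ on-1) = inj₂ on-1
        ... | inj₂ (inj₂ on-2) = ⊥-elim (peg≢endPeg s true s-free on-2)

      turn-top : ∀ {e s c} → TowerOn K e (underTower K s B) c → dial c (suc K) ≡ s →
        val s ≢ end e → val (next s) ≢ end e →
        TowerOn K e (underTower K (next s) B) (turn m (suc K) c) × dial (turn m (suc K) c) (suc K) ≡ next s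
      turn-top {e} {s} {c} I top s-free next-free = record
        { tower-dials = λ i i<K → trans (turn-dial-other (suc K) c (λ i+1≡K+1 → <⇒≢ i<K (suc-injective i+1≡K+1)))
                                        (tower-dials i i<K)
        ; tower-pegs  = λ q → trans (DiskAt.pegs≡ moved q)
            (stackAt-swap (peg (next s)) (endPeg e) [ suc K ] (tower K) q (B q) (peg≢endPeg (next s) e next-free))
        ; rest-larger = λ q → ++⁺ (stackAt-All (peg (next s)) [ suc K ] q (n<1+n K ∷ []))
            (All.map (<-trans (n<1+n K)) (B-larger q))
        } , DiskAt.dial≡ moved
        where
        open TowerOn I
        others : ℕ → List ℕ
        others q = stackAt (endPeg e) (tower K) q ++ B q
        others-≢ : ∀ q → All (_≢ suc K) (others q)
        others-≢ q = ++⁺ (stackAt-All (endPeg e) (tower K) q (All.map (λ i≤K → <⇒≢ (s≤s i≤K)) (tower-≤ K)))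
                         (All.map >⇒≢ (B-larger q))
        moved : DiskAt (suc K) (next s) others (turn m (suc K) c)
        moved = turn-DiskAt (record
          { dial≡ = top
          ; pegs≡ = λ q → trans (tower-pegs q)
              (stackAt-swap (endPeg e) (peg s) (tower K) [ suc K ] q (B q) (λ on-end → peg≢endPeg s e s-free (sym on-end)))
          }) others-≢

      upper-below : ∀ {c₀ c s} → SameAbove (suc K) c₀ c → dial c (suc K) ≡ s →
        upperDigits (n ∸ K) K c ≡ upperDigits (n ∸ suc K) (suc K) c₀ ++ [ val s ]
      upper-below {c₀} {c} {s} same top = begin
        upperDigits (n ∸ K) K c
          ≡⟨ cong (λ j → upperDigits j K c) (+-∸-assoc 1 k+2≤n) ⟩
        upperDigits (suc (n ∸ suc K)) K c
          ≡⟨ upperDigits-suc (n ∸ suc K) K c ⟩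
        upperDigits (n ∸ suc K) (suc K) c ++ [ val (dial c (suc K)) ]
          ≡⟨ cong₂ (λ u d → u ++ [ val d ]) (upperDigits-cong (n ∸ suc K) (suc K) same) top ⟩
        upperDigits (n ∸ suc K) (suc K) c₀ ++ [ val s ]
          ∎
        where open ≡-Reasoning

      tuple-towerOn : ∀ {e s B′ c₀ c} → TowerOn K e B′ c → dial c (suc K) ≡ s → SameAbove (suc K) c₀ c →
        tuple m n c ≡ upperDigits (n ∸ suc K) (suc K) c₀ ++ val s ∷ replicate K (val (end e))
      tuple-towerOn {e} {s} {c₀ = c₀} {c} I top same = begin
        tuple m n c
          ≡⟨ tuple-split {K = K} c (<⇒≤ k+2≤n) ⟩
        upperDigits (n ∸ K) K c ++ tuple m K c
          ≡⟨ cong₂ _++_ (upper-below same top) (tuple-end K e c (TowerOn.tower-dials I)) ⟩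
        (upperDigits (n ∸ suc K) (suc K) c₀ ++ [ val s ]) ++ replicate K (val (end e))
          ≡⟨ ++-assoc (upperDigits (n ∸ suc K) (suc K) c₀) [ val s ] (replicate K (val (end e))) ⟩
        upperDigits (n ∸ suc K) (suc K) c₀ ++ val s ∷ replicate K (val (end e))
          ∎
        where open ≡-Reasoning

      runs-stages : ∀ r {s e E c₀ c} → Admissible s e r E →
        TowerOn K e (underTower K s B) c → dial c (suc K) ≡ s → SameAbove (suc K) c₀ c →
        Runs c (suc r * m ^ k) (map (upperDigits (n ∸ suc K) (suc K) c₀ ++_) (drop 1 (stages K s e r)))
          (λ c′ → TowerOn (suc K) E B c′ × SameAbove (suc K) c₀ c′)
      runs-stages zero {s} {e} {c₀ = c₀} {c} (refl , refl) I top same =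
        runs-cast (sym (+-identityʳ (m ^ k))) trace joined (sweeps-k e (underTower K s B) c I)
        where
        joined : ∀ {c′} → TowerOn K (not e) (underTower K s B) c′ × SameAbove K c c′ →
          TowerOn (suc K) (not e) B c′ × SameAbove (suc K) c₀ c′
        joined (I′ , same′) =
          towerOn-join I′ (trans (above same′ (suc K) (n<1+n K)) top) B-larger , sameAbove-trans same same′ (n≤1+n K)
        trace : map (upperDigits (n ∸ K) K c ++_) (drop 1 (sweep K e)) ≡
                map (upperDigits (n ∸ suc K) (suc K) c₀ ++_) (drop 1 (stages K s e zero))
        trace = trans (cong (λ u → map (u ++_) (drop 1 (sweep K e))) (upper-below same top))
                      (prefix-stages-zero (upperDigits (n ∸ suc K) (suc K) c₀) K s e)
      runs-stages (suc r) {s} {e} {E} {c₀} {c} (s-free , next-free , admissible) I top same =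
        runs-cast refl trace id (runs-chain (sweeps-k e (underTower K s B) c I) continue)
        where
        upper : List ℕ
        upper = upperDigits (n ∸ suc K) (suc K) c₀
        continue : ∀ {c′} → TowerOn K (not e) (underTower K s B) c′ × SameAbove K c c′ →
          chooseDisk m c′ ≡ just (suc K) ×
          tuple m n (turn m (suc K) c′) ≡ upper ++ val (next s) ∷ replicate K (val (end (not e))) ×
          Runs (turn m (suc K) c′) (suc r * m ^ k) (map (upper ++_) (drop 1 (stages K (next s) (not e) r)))
            (λ c″ → TowerOn (suc K) E B c″ × SameAbove (suc K) c₀ c″)
        continue {c′} (I′ , same′) with turn-top I′ (trans (above same′ (suc K) (n<1+n K)) top) s-free next-free
        ... | I″ , top″ = chooses-top {s = s} I′ s-free , tuple-towerOn I″ top″ same″ , runs-stages r admissible I″ top″ same″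
          where
          same″ : SameAbove (suc K) c₀ (turn m (suc K) c′)
          same″ = sameAbove-trans (sameAbove-trans same same′ (n≤1+n K)) (turn-sameAbove (suc K) c′) ≤-refl
        later : List (List ℕ)
        later = (upper ++ val (next s) ∷ replicate K (val (end (not e)))) ∷
                map (upper ++_) (drop 1 (stages K (next s) (not e) r))
        trace : map (upperDigits (n ∸ K) K c ++_) (drop 1 (sweep K e)) ++ later ≡
                map (upper ++_) (drop 1 (stages K s e (suc r)))
        trace = trans (cong (λ u → map (u ++_) (drop 1 (sweep K e)) ++ later) (upper-below same top))
                      (prefix-stages-suc upper K s e r)

    towerSweeps : ∀ k → suc k ≤ n → TowerSweeps k
    towerSweeps zero    1≤n = towerSweeps-0 1≤n
    towerSweeps (suc k) k+2≤n e B c I =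
      TowerStep.runs-stages k k+2≤n (towerSweeps k (<⇒≤ k+2≤n)) B (TowerOn.rest-larger I) M (admissible-end e)
        (towerOn-split I) (TowerOn.tower-dials I (suc k) ≤-refl) sameAbove-refl

    initial-towerOn : TowerOn n false (λ _ → []) (initial m n)
    initial-towerOn = record
      { tower-dials = λ _ _ → refl
      ; tower-pegs  = pegs-initial
      ; rest-larger = λ _ → []
      }
      where
      pegs-initial : ∀ q → pegs (initial m n) q ≡ stackAt 0 (tower n) q ++ []
      pegs-initial q with q ≡ᵇ 0
      ... | true  = trans (map-suc-upTo n) (sym (++-identityʳ (tower n)))
      ... | false = refl

    towerOn-stops : ∀ {K B c} → TowerOn (suc K) true B c → B 0 ≡ [] → B 1 ≡ [] → chooseDisk m c ≡ nothing
    towerOn-stops {c = c} I B0≡[] B1≡[]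
      rewrite chooseDisk-P₂ c (trans (cong peg (TowerOn.tower-dials I 0 (s≤s z≤n))) (peg-end true))
            | TowerOn.tower-pegs I 0 | TowerOn.tower-pegs I 1 | B0≡[] | B1≡[] = refl

  oddCompressed-gray : ∀ n₀ → oddCompressed m (suc n₀) (m ^ n₀ + 0) ≡ just (gray m (suc n₀))
  oddCompressed-gray n₀ = begin
    appendTo m [ tuple m n c₀ ] (runLoop m n (m ^ n₀ + 0) c₀)
      ≡⟨ cong (appendTo m [ tuple m n c₀ ])
              (runs-stop (towerSweeps n₀ ≤-refl false (λ _ → []) c₀ initial-towerOn) (λ (I , _) → towerOn-stops I refl refl)) ⟩
    just (tuple m n c₀ ∷ map (upperDigits (n ∸ n) n c₀ ++_) (drop 1 (sweep n false)))
      ≡⟨ cong just (cong₂ _∷_ (tuple-end n false c₀ (λ _ _ → refl))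
                              (trans (cong (λ j → map (upperDigits j n c₀ ++_) (drop 1 (sweep n false))) (n∸n≡0 n))
                                     (map-id (drop 1 (sweep n false))))) ⟩
    just (replicate n (val (end false)) ∷ drop 1 (sweep n false))
      ≡⟨ cong just (sym (trans (gray≡sweep n) (sweep-head n false))) ⟩
    just (gray m n)
      ∎
    where
    open ≡-Reasoning
    n : ℕ
    n = suc n₀
    open Run n
    c₀ : Config
    c₀ = initial m n

mainTheorem4 : (m n : ℕ) → 3 ≤ m → m % 2 ≡ 1 → 1 ≤ n →
    ∃[ fuel ] oddCompressed m n fuel ≡ just (gray m n)
mainTheorem4 (suc M) (suc n₀) (s≤s 2≤M) m-odd _ =
  suc M ^ n₀ + 0 , OddCompressed.oddCompressed-gray M 2≤M (not-injective (%2≡1⇒odd (suc M) m-odd)) n₀
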